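{- Let $(D,\sqsubseteq)$ be a finite partial ordering with least element $\bot$ and greatest element $\top$, and let $F$ be a finite set of functions $D\to D$, each inflationary and monotonic. Suppose that for each $g\in F$ and $d\in D$ two lists $\mathit{friends}(g,d)$ and $\mathit{obviated}(g,d)$ of functions from $F$ are given such that the following condition (*) holds: for every $g\in F$ and every $d\in D$, writing $\mathit{friends}(g,d)=[g_1,\ldots,g_k]$, for every $e$ with $g\circ g_1\circ\cdots\circ g_k(d)\sqsubseteq e$ and every $f\in \mathit{friends}(g,d)\cup\mathit{obviated}(g,d)$ we have $f(e)=e$. Then every execution of the Revised Generic Iteration Algorithm (RGI) described in the context terminates, and upon termination $d$ equals the least common fixpoint of the functions in the original set $F$ (the value $F_0$).
   Context: A function $f:D\to D$ is inflationary if $x\sqsubseteq f(x)$ for all $x$, and monotonic if $x\sqsubseteq y$ implies $f(x)\sqsubseteq f(y)$. Revised Generic Iteration Algorithm (RGI): $d:=\bot$; $F_0:=F$; $G:=F$; while $G\neq\emptyset$ and $d\neq\top$ do: choose $g\in G$; $G:=G-\{g\}$; $F:=F-(\mathit{friends}(g,d)\cup\mathit{obviated}(g,d))$; $G:=G-(\mathit{friends}(g,d)\cup\mathit{obviated}(g,d))$; $G:=G\cup\mathit{update}(G,h,d)$, where $\mathit{friends}(g,d)=[g_1,\ldots,g_k]$ and $h=g\circ g_1\circ\cdots\circ g_k$; $d:=h(d)$; end. (The lists are identified with sets where set operations are used.) Here $\mathit{update}(G,h,d)$ is a subset of the current set $F$ satisfying, for all $G,h,d$: (A) $\{f\in F-G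 \mid f(d)=d \wedge f(h(d))\neq h(d)\}\subseteq \mathit{update}(G,h,d)$; (B) $h(d)=d$ implies $\mathit{update}(G,h,d)=\emptyset$; (C) $h(h(d))\neq h(d)$ implies $h\in\mathit{update}(G,h,d)$. -}

module Defs where

open import Level using (Level; _⊔_)
open import Data.Nat using (ℕ)
open import Data.Fin using (Fin)
open import Data.Fin.Subset using (Subset; _∈_; _∉_; _⊆_; _∪_; _─_; _-_; ⁅_⁆)
  renaming (⊥ to ∅; ⊤ to full)
open import Data.List using (List; foldr)
open import Data.Product using (Σ; _×_; ∃)
open import Data.Sum using (_⊎_)
open import Function using (_∘_; id)
open import Relation.Binary.PropositionalEquality using (_≡_; _≢_)

listToSubset : ∀ {n} → List (Fin n) → Subset n
listToSubset = foldr (λ i s → ⁅ i ⁆ ∪ s) ∅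

-- The algorithm, for a carrier D with order _⊑_, bottom ⊥, top ⊤,
-- a finite family of functions F0 = { fun i | i : Fin n }, and the
-- friends / obviated lists (as lists of indices into the family).
module RGI {a : Level} (D : Set a) (⊤ᴰ ⊥ᴰ : D) (n : ℕ) (fun : Fin n → D → D)
           (friends obviated : Fin n → D → List (Fin n)) where

  composeList : List (Fin n) → D → D
  composeList = foldr (λ i acc → fun i ∘ acc) id

  hOf : Fin n → D → (D → D)
  hOf g d = fun g ∘ composeList (friends g d)

  record State : Set a where
    constructor ⟨_,_,_⟩
    field
      Fs : Subset n
      Gs : Subset n
      dv : D

  open State public

  initial : State
  initial = ⟨ full , full , ⊥ᴰ ⟩

  -- one iteration of the while loop: guard holds, g ∈ G is chosen, and the
  -- set returned by update is any U satisfying (A), (B), (C) for the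
  -- current F, G, h, d.
  data Step : State → State → Set a where
    step : ∀ (F G : Subset n) (d : D) (g : Fin n) (U : Subset n) →
      let R  = listToSubset (friends g d) ∪ listToSubset (obviated g d)
          h  = hOf g d
          F₁ = F ─ R
          G₁ = (G - g) ─ R
      in
      g ∈ G →
      d ≢ ⊤ᴰ →
      U ⊆ F₁ →
      (∀ f → f ∈ F₁ → f ∉ G₁ → fun f d ≡ d →
             fun f (h d) ≢ h d → f ∈ U) →               -- (A)
      (h d ≡ d → ∀ f → f ∉ U) →                         -- (B)
      (h (h d) ≢ h d → ∃ λ i → i ∈ U × (∀ x → fun i x ≡ h x)) →  -- (C)
      Step ⟨ F , G , d ⟩ ⟨ F₁ , G₁ ∪ U , h d ⟩

  Terminated : State → Set a
  Terminated s = (∀ g → g ∉ Gs s) ⊎ dv s ≡ ⊤ᴰ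

IsLeastCommonFixpoint : ∀ {a ℓ n} {D : Set a} (_⊑_ : D → D → Set ℓ) →
  (Fin n → D → D) → D → Set (a ⊔ ℓ)
IsLeastCommonFixpoint _⊑_ fun x =
  (∀ i → fun i x ≡ x) × (∀ y → (∀ i → fun i y ≡ y) → x ⊑ y)

module Submission where

-- Termination: a step either strictly raises d or, by (B), keeps d and shrinks G, and the
-- lexicographic order on (d, |G|) is well founded because D is finite.
-- Correctness: along every run d stays below each common fixpoint (every h is monotone and
-- fixes it), a function dropped from F is stable above d by (*), and a function of F outside
-- G either fixes d or agrees above d with some function still in G.  The last clause is kept
-- by (A) for functions disturbed by the new d and by (C) for g itself, which above h(d)
-- coincides with h.  So once G is empty every function fixes d, and d = ⊤ is a common
-- fixpoint by inflationarity.

open import Defs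
open import Level using (Level; _⊔_)
open import Data.Nat using (ℕ; _<_)
open import Data.Nat.Induction using (<-wellFounded)
open import Data.Nat.Properties using (≤-<-trans)
open import Data.Fin using (Fin) renaming (_≟_ to _≟ᶠ_)
open import Data.Fin.Properties using (inj⇒≟)
open import Data.Fin.Induction using (po-noetherian)
open import Data.Fin.Subset using (Subset; ⁅_⁆; _∪_; _─_; _-_; ∣_∣)
  renaming (_∈_ to _∈ˢ_; _∉_ to _∉ˢ_; ⊥ to ∅)
open import Data.Fin.Subset.Properties
  using (_∈?_; ∈⊤; ∉⊥; x∈⁅y⁆⇒x≡y; x∈p∪q⁻; x∈p∪q⁺; x∈p∧x∉q⇒x∈p─q; x∈p∧x≢y⇒x∈p-y;
         p─q⊆p; p⊆q⇒∣p∣≤∣q∣; x∈p⇒∣p-x∣<∣p∣; Empty-unique; ∪-identityʳ)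
open import Data.List using (List; []; _∷_)
open import Data.List.Membership.Propositional using (_∈_)
open import Data.List.Relation.Unary.Any using (here; there)
open import Data.Product using (_×_; _,_; ∃)
open import Data.Product.Relation.Binary.Lex.Strict using (×-Lex; ×-wellFounded)
open import Data.Sum using (_⊎_; inj₁; inj₂)
open import Function using (flip; _∘_; _on_)
open import Function.Bundles using (_↔_; Inverse)
open import Function.Properties.Inverse using (↔⇒↣)
open import Relation.Nullary using (yes; no; contradiction)
open import Relation.Binary.Core using (Rel)
open import Relation.Binary.Definitions using (DecidableEquality)
open import Relation.Binary.Structures using (IsPartialOrder)
open import Relation.Binary.PropositionalEquality
  using (_≡_; _≢_; refl; sym; trans; cong; subst; subst₂)
import Relation.Binary.Construct.NonStrictToStrict as ToStrict
import Relation.Binary.Construct.On as On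
open import Relation.Binary.Construct.Closure.ReflexiveTransitive using (Star; ε; _◅_)
open import Induction.WellFounded using (WellFounded; Acc; module Subrelation)

∈-listToSubset⁻ : ∀ {k} (L : List (Fin k)) {i} → i ∈ˢ listToSubset L → i ∈ L
∈-listToSubset⁻ []      i∈ = contradiction i∈ ∉⊥
∈-listToSubset⁻ (j ∷ L) i∈ with x∈p∪q⁻ ⁅ j ⁆ (listToSubset L) i∈
... | inj₁ i∈⁅j⁆ = here (x∈⁅y⁆⇒x≡y j i∈⁅j⁆)
... | inj₂ i∈L   = there (∈-listToSubset⁻ L i∈L)

module _ {a ℓ} {D : Set a} {_⊑_ : Rel D ℓ} (po : IsPartialOrder _≡_ _⊑_) where

  finite-po-noetherian : ∀ {m} → D ↔ Fin m → WellFounded (flip (ToStrict._<_ _≡_ _⊑_))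
  finite-po-noetherian D↔Fin = Subrelation.wellFounded ⊐⇒⊐ᶠ (On.wellFounded to ⊐ᶠ-wellFounded)
    where
    open Inverse D↔Fin using (to; from; strictlyInverseʳ)
    ⊐ᶠ-wellFounded : WellFounded (flip (ToStrict._<_ (_≡_ on from) (_⊑_ on from)))
    ⊐ᶠ-wellFounded = po-noetherian (On.isPartialOrder from po)
    ⊐⇒⊐ᶠ : ∀ {x y} → y ⊑ x × y ≢ x →
           from (to y) ⊑ from (to x) × from (to y) ≢ from (to x)
    ⊐⇒⊐ᶠ {x} {y} = subst₂ (λ u v → u ⊑ v × u ≢ v) (sym (strictlyInverseʳ y)) (sym (strictlyInverseʳ x))

module Iteration {a ℓ} (D : Set a) (_⊑_ : Rel D ℓ) (po : IsPartialOrder _≡_ _⊑_)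
    (_≟_ : DecidableEquality D) (⊥ᴰ ⊤ᴰ : D)
    (n : ℕ) (fun : Fin n → D → D)
    (inflationary : ∀ i x → x ⊑ fun i x)
    (monotone : ∀ i x y → x ⊑ y → fun i x ⊑ fun i y)
    (friends obviated : Fin n → D → List (Fin n)) where

  open RGI D ⊤ᴰ ⊥ᴰ n fun friends obviated
  open IsPartialOrder po using (antisym) renaming (refl to ⊑-refl; trans to ⊑-trans)

  CommonFixpoint : D → Set a
  CommonFixpoint y = ∀ i → fun i y ≡ y

  composeList-inflationary : ∀ L x → x ⊑ composeList L x
  composeList-inflationary []      x = ⊑-refl
  composeList-inflationary (i ∷ L) x = ⊑-trans (composeList-inflationary L x) (inflationary i _)

  composeList-monotone : ∀ L x y → x ⊑ y → composeList L x ⊑ composeList L y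
  composeList-monotone []      x y x⊑y = x⊑y
  composeList-monotone (i ∷ L) x y x⊑y = monotone i _ _ (composeList-monotone L x y x⊑y)

  composeList-fixed : ∀ L x → (∀ i → i ∈ L → fun i x ≡ x) → composeList L x ≡ x
  composeList-fixed []      x fixed = refl
  composeList-fixed (i ∷ L) x fixed = trans
    (cong (fun i) (composeList-fixed L x (λ j j∈L → fixed j (there j∈L))))
    (fixed i (here refl))

  hOf-inflationary : ∀ g d x → x ⊑ hOf g d x
  hOf-inflationary g d x = ⊑-trans (composeList-inflationary (friends g d) x) (inflationary g _)

  hOf-monotone : ∀ g d x y → x ⊑ y → hOf g d x ⊑ hOf g d y
  hOf-monotone g d x y x⊑y = monotone g _ _ (composeList-monotone (friends g d) x y x⊑y)

  hOf-commonFixpoint : ∀ g d y → CommonFixpoint y → hOf g d y ≡ y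
  hOf-commonFixpoint g d y fixed =
    trans (cong (fun g) (composeList-fixed (friends g d) y (λ i _ → fixed i))) (fixed g)

  Removed : Fin n → D → Subset n
  Removed g d = listToSubset (friends g d) ∪ listToSubset (obviated g d)

  _⊏_ : Rel D (a ⊔ ℓ)
  x ⊏ y = x ⊑ y × x ≢ y

  rank : State → D × ℕ
  rank s = dv s , ∣ Gs s ∣

  _≺_ : Rel (D × ℕ) (a ⊔ ℓ)
  _≺_ = ×-Lex _≡_ (flip _⊏_) _<_

  -- When h does not move d, (B) empties the update and G loses g.
  Step-decreases-rank : ∀ {s s'} → Step s s' → rank s' ≺ rank s
  Step-decreases-rank (step F G d g U g∈G _ _ _ B _) with hOf g d d ≟ d
  ... | no  hd≢d = inj₁ (hOf-inflationary g d d , hd≢d ∘ sym)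
  ... | yes hd≡d = inj₂ (hd≡d , ≤-<-trans (p⊆q⇒∣p∣≤∣q∣ G'⊆G-g) (x∈p⇒∣p-x∣<∣p∣ g∈G))
    where
    U≡∅ : U ≡ ∅
    U≡∅ = Empty-unique (λ (f , f∈U) → B hd≡d f f∈U)
    G'⊆G-g : ∀ {f} → f ∈ˢ ((G - g) ─ Removed g d) ∪ U → f ∈ˢ G - g
    G'⊆G-g rewrite U≡∅ | ∪-identityʳ ((G - g) ─ Removed g d) = p─q⊆p (G - g) (Removed g d)

  Step-wellFounded : WellFounded (flip _⊏_) → WellFounded (flip Step)
  Step-wellFounded ⊐-wellFounded = Subrelation.wellFounded Step-decreases-rank
    (On.wellFounded rank (×-wellFounded ⊐-wellFounded <-wellFounded))

  module Correctness (⊥-least : ∀ x → ⊥ᴰ ⊑ x) (⊤-greatest : ∀ x → x ⊑ ⊤ᴰ)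
      (stable : ∀ g d e → hOf g d d ⊑ e →
        ∀ f → (f ∈ friends g d ⊎ f ∈ obviated g d) → fun f e ≡ e) where

    Removed-stable : ∀ g d f e → f ∈ˢ Removed g d → hOf g d d ⊑ e → fun f e ≡ e
    Removed-stable g d f e f∈R hd⊑e with x∈p∪q⁻ (listToSubset (friends g d)) _ f∈R
    ... | inj₁ f∈friends  = stable g d e hd⊑e f (inj₁ (∈-listToSubset⁻ _ f∈friends))
    ... | inj₂ f∈obviated = stable g d e hd⊑e f (inj₂ (∈-listToSubset⁻ _ f∈obviated))

    -- Above h(d) the friends of g are inert, so h acts there as g alone.
    hOf-above : ∀ g d x → hOf g d d ⊑ x → hOf g d x ≡ fun g x
    hOf-above g d x hd⊑x = cong (fun g)
      (composeList-fixed (friends g d) x (λ i i∈ → stable g d x hd⊑x i (inj₁ i∈)))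

    AgreeAbove : D → Fin n → Fin n → Set (a ⊔ ℓ)
    AgreeAbove d j f = ∀ x → d ⊑ x → fun j x ≡ fun f x

    Represented : Subset n → D → Fin n → Set (a ⊔ ℓ)
    Represented G d f = ∃ λ j → j ∈ˢ G × AgreeAbove d j f

    Settled : State → Fin n → Set (a ⊔ ℓ)
    Settled s f = fun f (dv s) ≡ dv s ⊎ Represented (Gs s) (dv s) f

    record Invariant (s : State) : Set (a ⊔ ℓ) where
      field
        below-commonFixpoints : ∀ y → CommonFixpoint y → dv s ⊑ y
        unscheduled-settled   : ∀ f → f ∈ˢ Fs s → f ∉ˢ Gs s → Settled s f
        discarded-stable      : ∀ f → f ∉ˢ Fs s → ∀ e → dv s ⊑ e → fun f e ≡ e
    open Invariant

    Invariant-initial : Invariant initial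
    Invariant-initial = record
      { below-commonFixpoints = λ y _ → ⊥-least y
      ; unscheduled-settled   = λ f _ f∉full → contradiction ∈⊤ f∉full
      ; discarded-stable      = λ f f∉full → contradiction ∈⊤ f∉full
      }

    Step-represented : ∀ {s s'} → Step s s' → ∀ f → Represented (Gs s) (dv s) f →
                       fun f (dv s') ≢ dv s' → Represented (Gs s') (dv s') f
    Step-represented (step F G d g U _ _ _ _ _ C) f (j , j∈G , j≈f) fhd≢hd
      with j ∈? Removed g d | j ≟ᶠ g
    ... | yes j∈R | _ = contradiction
      (trans (sym (j≈f _ (hOf-inflationary g d d))) (Removed-stable g d j _ j∈R ⊑-refl)) fhd≢hd
    ... | no _ | yes refl =
      let (i , i∈U , i≗h) = C (λ hhd≡hd → fhd≢hd (fhd≡hd hhd≡hd)) in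
      i , x∈p∪q⁺ (inj₂ i∈U) , λ x hd⊑x → trans (i≗h x)
        (trans (hOf-above g d x hd⊑x) (j≈f x (⊑-trans (hOf-inflationary g d d) hd⊑x)))
      where
      fhd≡hd : hOf g d (hOf g d d) ≡ hOf g d d → fun f (hOf g d d) ≡ hOf g d d
      fhd≡hd hhd≡hd = trans (sym (j≈f _ (hOf-inflationary g d d)))
        (trans (sym (hOf-above g d _ ⊑-refl)) hhd≡hd)
    ... | no j∉R | no j≢g =
      j , x∈p∪q⁺ (inj₁ (x∈p∧x∉q⇒x∈p─q (x∈p∧x≢y⇒x∈p-y j∈G j≢g) j∉R)) ,
      λ x hd⊑x → j≈f x (⊑-trans (hOf-inflationary g d d) hd⊑x)

    Step-unscheduled-settled : ∀ {s s'} → Step s s' → (∀ f → f ∈ˢ Fs s → f ∉ˢ Gs s → Settled s f) →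
                   ∀ f → f ∈ˢ Fs s' → f ∉ˢ Gs s' → Settled s' f
    Step-unscheduled-settled st@(step F G d g U _ _ _ A _ _) settled f f∈F' f∉G'
      with fun f (hOf g d d) ≟ hOf g d d
    ... | yes fixed = inj₁ fixed
    ... | no  moved = inj₂ (Step-represented st f represented moved)
      where
      represented : Represented G d f
      represented with f ∈? G
      ... | yes f∈G = f , f∈G , λ _ _ → refl
      ... | no  f∉G with settled f (p─q⊆p F (Removed g d) f∈F') f∉G
      ...   | inj₂ rep   = rep
      ...   | inj₁ fd≡d = contradiction
        (A f f∈F' (f∉G' ∘ x∈p∪q⁺ ∘ inj₁) fd≡d moved) (f∉G' ∘ x∈p∪q⁺ ∘ inj₂)

    Step-discarded-stable : ∀ {s s'} → Step s s' → (∀ f → f ∉ˢ Fs s → ∀ e → dv s ⊑ e → fun f e ≡ e) →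
                     ∀ f → f ∉ˢ Fs s' → ∀ e → dv s' ⊑ e → fun f e ≡ e
    Step-discarded-stable (step F G d g U _ _ _ _ _ _) discarded f f∉F' e hd⊑e
      with f ∈? F | f ∈? Removed g d
    ... | no  f∉F | _       = discarded f f∉F e (⊑-trans (hOf-inflationary g d d) hd⊑e)
    ... | yes _   | yes f∈R = Removed-stable g d f e f∈R hd⊑e
    ... | yes f∈F | no  f∉R = contradiction (x∈p∧x∉q⇒x∈p─q f∈F f∉R) f∉F'

    Step-below-commonFixpoints : ∀ {s s'} → Step s s' → (∀ y → CommonFixpoint y → dv s ⊑ y) →
                 ∀ y → CommonFixpoint y → dv s' ⊑ y
    Step-below-commonFixpoints (step F G d g U _ _ _ _ _ _) below y fixed =
      subst (hOf g d d ⊑_) (hOf-commonFixpoint g d y fixed) (hOf-monotone g d d y (below y fixed))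

    Invariant-step : ∀ {s s'} → Invariant s → Step s s' → Invariant s'
    Invariant-step inv st = record
      { below-commonFixpoints = Step-below-commonFixpoints st (below-commonFixpoints inv)
      ; unscheduled-settled   = Step-unscheduled-settled st (unscheduled-settled inv)
      ; discarded-stable      = Step-discarded-stable st (discarded-stable inv)
      }

    Invariant-star : ∀ {s s'} → Invariant s → Star Step s s' → Invariant s'
    Invariant-star inv ε          = inv
    Invariant-star inv (st ◅ sts) = Invariant-star (Invariant-step inv st) sts

    Invariant-terminated : ∀ {s} → Invariant s → Terminated s → CommonFixpoint (dv s)
    Invariant-terminated inv (inj₂ d≡⊤) i rewrite d≡⊤ = antisym (⊤-greatest _) (inflationary i ⊤ᴰ)
    Invariant-terminated {s} inv (inj₁ G-empty) i with i ∈? Fs s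
    ... | no  i∉F = discarded-stable inv i i∉F (dv s) ⊑-refl
    ... | yes i∈F with unscheduled-settled inv i i∈F (G-empty i)
    ...   | inj₁ fixed          = fixed
    ...   | inj₂ (j , j∈G , _) = contradiction j∈G (G-empty j)

    terminated-leastCommonFixpoint : ∀ s → Star Step initial s → Terminated s →
                                     IsLeastCommonFixpoint _⊑_ fun (dv s)
    terminated-leastCommonFixpoint s reach done =
      Invariant-terminated inv done , below-commonFixpoints inv
      where inv = Invariant-star Invariant-initial reach

theorem2 : ∀ {a ℓ : Level} (D : Set a) (_⊑_ : D → D → Set ℓ) →
    IsPartialOrder _≡_ _⊑_ →
    (m : ℕ) → D ↔ Fin m →
    (⊥ᴰ ⊤ᴰ : D) → (∀ x → ⊥ᴰ ⊑ x) → (∀ x → x ⊑ ⊤ᴰ) →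
    (n : ℕ) (fun : Fin n → D → D) →
    (∀ i j → (∀ x → fun i x ≡ fun j x) → i ≡ j) →
    (∀ i x → x ⊑ fun i x) →
    (∀ i x y → x ⊑ y → fun i x ⊑ fun i y) →
    (friends obviated : Fin n → D → List (Fin n)) →
    (∀ g d e → RGI.hOf D ⊤ᴰ ⊥ᴰ n fun friends obviated g d d ⊑ e →
      ∀ f → (f ∈ friends g d ⊎ f ∈ obviated g d) → fun f e ≡ e) →
    let open RGI D ⊤ᴰ ⊥ᴰ n fun friends obviated in
    Acc (flip Step) initial ×
    (∀ s → Star Step initial s → Terminated s →
      IsLeastCommonFixpoint _⊑_ fun (dv s))
theorem2 D _⊑_ po m D↔Fin ⊥ᴰ ⊤ᴰ ⊥-least ⊤-greatest n fun _ inflationary monotone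
         friends obviated stable =
  Step-wellFounded (finite-po-noetherian po D↔Fin) initial ,
  terminated-leastCommonFixpoint
  where
  open Iteration D _⊑_ po (inj⇒≟ (↔⇒↣ D↔Fin)) ⊥ᴰ ⊤ᴰ n fun
                 inflationary monotone friends obviated
  open RGI D ⊤ᴰ ⊥ᴰ n fun friends obviated using (initial)
  open Correctness ⊥-least ⊤-greatest stable
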